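{- Let $t$ and $s$ be KL terms over $\Sigma$ and let $x$ be a label. Then $\mathsf{REL} \models t \le s$ if and only if $\mathsf{REL} \models @x.t \le @x.s$.
   Context: KL terms over $\Sigma$: $t ::= a \mid 1 \mid 0 \mid t;t \mid t+t \mid t\cap t \mid t^{*}$, $a\in\Sigma$. A structure $S$ is a non-empty set $|S|$ (an arbitrary set, whose elements may be labels) with $a^S\subseteq|S|^2$ for each $a\in\Sigma$; semantics $[\![a]\!]_S=a^S$, $[\![1]\!]_S$ = identity on $|S|$, $[\![0]\!]_S=\emptyset$, $;,+,\cap,{}^{*}$ are composition, union, intersection, reflexive-transitive closure. $\mathsf{REL}$ = class of all structures. $\mathsf{REL}\models t\le s$ means $[\![t]\!]_S\subseteq[\![s]\!]_S$ for all structures $S$. For a label (any object) $x$ and KL term $t$, the labeled term $@x.t$ has semantics the unary relation $[\![@x.t]\!]_S=\{y : (x,y)\in[\![t]\!]_S\}\subseteq|S|$ (empty if $x\notin|S|$), and $\mathsf{REL}\models @x.t\le @x.s$ means $[\![@x.t]\!]_S\subseteq[\![@x.s]\!]_S$ for all structures $S$. -}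

module Defs where

open import Data.Product using (Σ-syntax; _×_; _,_)
open import Relation.Binary.PropositionalEquality using (_≡_)
open import Data.Sum using (_⊎_)
open import Data.Empty using (⊥)
open import Function.Definitions using (Injective)

data Term (A : Set) : Set where
  atom : A → Term A
  one  : Term A
  zer  : Term A
  _⨾_  : Term A → Term A → Term A
  _⊕_  : Term A → Term A → Term A
  _⊓_  : Term A → Term A → Term A
  _⋆   : Term A → Term A

record Structure (A L : Set) : Set₁ where
  field
    dom      : L → Set
    nonempty : Σ[ z ∈ L ] dom z
    rel      : A → L → L → Set
    rel-dom  : ∀ a u v → rel a u v → dom u × dom v

open Structure public

data Star {L : Set} (D : L → Set) (R : L → L → Set) : L → L → Set where
  ε    : ∀ {u} → D u → Star D R u u
  step : ∀ {u v w} → R u v → Star D R v w → Star D R u w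

⟦_⟧ : ∀ {A L} → Term A → Structure A L → L → L → Set
⟦ atom a ⟧ S u v = rel S a u v
⟦ one ⟧ S u v = dom S u × (u ≡ v)
⟦ zer ⟧ S u v = ⊥
⟦ t ⨾ s ⟧ S u v = Σ[ w ∈ _ ] (⟦ t ⟧ S u w × ⟦ s ⟧ S w v)
⟦ t ⊕ s ⟧ S u v = ⟦ t ⟧ S u v ⊎ ⟦ s ⟧ S u v
⟦ t ⊓ s ⟧ S u v = ⟦ t ⟧ S u v × ⟦ s ⟧ S u v
⟦ t ⋆ ⟧ S u v = Star (dom S) (⟦ t ⟧ S) u v

⟦at_∙_⟧ : ∀ {A L} → L → Term A → Structure A L → L → Set
⟦at x ∙ t ⟧ S y = ⟦ t ⟧ S x y

REL⊨_≤_ : ∀ {A : Set} → Term A → Term A → Set₁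
REL⊨_≤_ {A} t s = ∀ (C : Set) (S : Structure A C) u v → ⟦ t ⟧ S u v → ⟦ s ⟧ S u v

-- Labels are
-- "arbitrary objects", so a structure may contain any further elements: we
-- quantify over every ambient type C into which the labels L embed injectively
-- (ι identifies each label with an element of C); |S| ⊆ C may or may not
-- contain ι x (if not, both sides are empty).
REL⊨at_∙_≤at_∙_ : ∀ {A L : Set} → L → Term A → L → Term A → Set₁
REL⊨at_∙_≤at_∙_ {A} {L} x t x' s =
  ∀ (C : Set) (ι : L → C) → Injective _≡_ _≡_ ι →
  ∀ (S : Structure A C) y → ⟦at ι x ∙ t ⟧ S y → ⟦at ι x' ∙ s ⟧ S y

{-# OPTIONS --safe #-}
module Submission where

open import Defs
open import Function.Bundles using (_⇔_; mk⇔)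
open import Data.Product using (_×_; _,_; proj₁; proj₂)
open import Data.Product.Properties using (,-injectiveʳ)
open import Data.Sum using (inj₁; inj₂)
open import Relation.Binary.PropositionalEquality using (refl)

-- Instantiating the equation at the label gives one direction. For the other,
-- tag every element of a structure S with a label: in the tagged structure the
-- labels l ↦ (u , l) embed injectively and the label x names the copy (u , x)
-- of an arbitrary source point u. Tagging with x and forgetting the tag are
-- homomorphisms, and KL terms are preserved by homomorphisms, so ⟦ t ⟧ S u v
-- transfers to the tagged structure and back.

record Homomorphism {A C D : Set} (S : Structure A C) (T : Structure A D) : Set where
  field
    map     : C → D
    map-dom : ∀ {u} → dom S u → dom T (map u)
    map-rel : ∀ a {u v} → rel S a u v → rel T a (map u) (map v)

module _ {A C D : Set} {S : Structure A C} {T : Structure A D} (h : Homomorphism S T) where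
  open Homomorphism h

  ⟦⟧-homomorphic : ∀ t {u v} → ⟦ t ⟧ S u v → ⟦ t ⟧ T (map u) (map v)
  Star-homomorphic : ∀ t {u v} → Star (dom S) (⟦ t ⟧ S) u v → Star (dom T) (⟦ t ⟧ T) (map u) (map v)

  ⟦⟧-homomorphic (atom a) r = map-rel a r
  ⟦⟧-homomorphic one (d , refl) = map-dom d , refl
  ⟦⟧-homomorphic zer ()
  ⟦⟧-homomorphic (t ⨾ s) (w , r₁ , r₂) = map w , ⟦⟧-homomorphic t r₁ , ⟦⟧-homomorphic s r₂
  ⟦⟧-homomorphic (t ⊕ s) (inj₁ r) = inj₁ (⟦⟧-homomorphic t r)
  ⟦⟧-homomorphic (t ⊕ s) (inj₂ r) = inj₂ (⟦⟧-homomorphic s r)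
  ⟦⟧-homomorphic (t ⊓ s) (r₁ , r₂) = ⟦⟧-homomorphic t r₁ , ⟦⟧-homomorphic s r₂
  ⟦⟧-homomorphic (t ⋆) r = Star-homomorphic t r

  Star-homomorphic t (ε d) = ε (map-dom d)
  Star-homomorphic t (step r rs) = step (⟦⟧-homomorphic t r) (Star-homomorphic t rs)

module _ {A C L : Set} (S : Structure A C) (x : L) where

  tagged : Structure A (C × L)
  tagged = record
    { dom      = λ p → dom S (proj₁ p)
    ; nonempty = (proj₁ (nonempty S) , x) , proj₂ (nonempty S)
    ; rel      = λ a p q → rel S a (proj₁ p) (proj₁ q)
    ; rel-dom  = λ a p q → rel-dom S a (proj₁ p) (proj₁ q)
    }

  tag : Homomorphism S tagged
  tag = record { map = _, x ; map-dom = λ d → d ; map-rel = λ a r → r }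

  untag : Homomorphism tagged S
  untag = record { map = proj₁ ; map-dom = λ d → d ; map-rel = λ a r → r }

proposition3p1 : ∀ {A L : Set} (t s : Term A) (x : L) → (REL⊨_≤_ {A} t s) ⇔ (REL⊨at x ∙ t ≤at x ∙ s)
proposition3p1 {L = L} t s x = mk⇔ labelled unlabelled
  where
  labelled : REL⊨ t ≤ s → REL⊨at x ∙ t ≤at x ∙ s
  labelled t≤s C ι _ S y = t≤s C S (ι x) y

  unlabelled : REL⊨at x ∙ t ≤at x ∙ s → REL⊨ t ≤ s
  unlabelled x∙t≤x∙s C S u v r =
    ⟦⟧-homomorphic (untag S x) s
      (x∙t≤x∙s (C × L) (u ,_) ,-injectiveʳ (tagged S x) (v , x)
        (⟦⟧-homomorphic (tag S x) t r))
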